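{- Let $G$ be a finite bipartite graph and $\{C,H\}$ a decomposition of $G$ such that $V(C)\cap V(H)=[n]=\{1,\dots,n\}$, all vertices of $[n]$ lie in the same bipartite class of $G$, every vertex of $[n]$ is 2-layered in $G$, and every vertex of $[n]$ has at least one neighbour in $C$ and at least one neighbour in $H$. Let $\Theta\subseteq[n]$, $\Gamma_1,\Gamma_2\subseteq\Theta^{\mathsf{c}}$ with $\Gamma_1\neq\Gamma_2$, and $b\in V(C)$. Then \[\mathcal{B}_{C\setminus\Gamma_1}\big(\Theta,\overline{\Theta^{\mathsf{c}}\cup N_C(\Gamma_1)}\big)\cap\mathcal{B}_{C\setminus\Gamma_2}\big(\Theta,\overline{\Theta^{\mathsf{c}}\cup N_C(\Gamma_2)}\big)=\emptyset\] and \[\mathcal{B}_{C\setminus\Gamma_1}\big(\{b\}\cup\Theta,\overline{\Theta^{\mathsf{c}}\cup N_C(\Gamma_1)}\big)\cap\mathcal{B}_{C\setminus\Gamma_2}\big(\{b\}\cup\Theta,\overline{\Theta^{\mathsf{c}}\cup N_C(\Gamma_2)}\big)=\emptyset.\]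
   Context: A stable set of a graph is a set of pairwise non-adjacent vertices; it is maximal if no further vertex can be added while keeping it stable. A decomposition of $G$ is a set of pairwise edge-disjoint subgraphs whose union (of vertex sets and edge sets) is $G$. A pendant vertex is a vertex of degree $1$ in $G$; a vertex $v$ is 2-layered in $G$ if every neighbour of $v$ in $G$ is adjacent to a pendant vertex of $G$. For $\Theta\subseteq[n]$, $\Theta^{\mathsf{c}}=[n]\setminus\Theta$. For a subgraph $K$ of $G$ and a vertex set $\Gamma$, $K\setminus\Gamma$ is the graph obtained from $K$ by deleting the vertices of $\Gamma$; $N_K(P)$ is the set of vertices adjacent in $K$ to some vertex of $P$. For vertex sets $P,Q$, $\mathcal{B}_K(P,\overline{Q})$ is the family of maximal stable sets of $K$ that contain every vertex of $P$ and no vertex of $Q$ (the intersections above are intersections of such families of sets). -}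

module Defs where

open import Data.Nat using (ℕ; _<_)
open import Data.Fin using (Fin; toℕ)
open import Data.Fin.Subset using (Subset; _∈_; _∉_; _∪_; ⁅_⁆)
open import Data.Bool using (Bool)
open import Data.Product using (Σ; ∃; _×_)
open import Data.Sum using (_⊎_)
open import Data.Empty using (⊥)
open import Relation.Nullary using (¬_)
open import Relation.Binary.PropositionalEquality using (_≡_; _≢_)

record Graph (N : ℕ) : Set₁ where
  field
    Adj    : Fin N → Fin N → Set
    sym    : ∀ {u v} → Adj u v → Adj v u
    irrefl : ∀ {u} → ¬ Adj u u
open Graph public

record SubG (N : ℕ) : Set₁ where
  field
    V    : Fin N → Set
    E    : Fin N → Fin N → Set
    Esym : ∀ {u v} → E u v → E v u
    Eend : ∀ {u v} → E u v → V u × V v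
open SubG public

record Decomposition {N : ℕ} (G : Graph N) (C H : SubG N) : Set where
  field
    C-sub    : ∀ {u v} → E C u v → Adj G u v
    H-sub    : ∀ {u v} → E H u v → Adj G u v
    disjoint : ∀ {u v} → E C u v → E H u v → ⊥
    edges    : ∀ {u v} → Adj G u v → E C u v ⊎ E H u v
    verts    : ∀ v → V C v ⊎ V H v

ProperColouring : ∀ {N} → Graph N → (Fin N → Bool) → Set
ProperColouring G c = ∀ {u v} → Adj G u v → c u ≢ c v

-- [n] = {1,…,n}, realised as the vertices 0,…,n-1 of Fin N.
InN : ∀ {N} → ℕ → Fin N → Set
InN n v = toℕ v < n

Pendant : ∀ {N} → Graph N → Fin N → Set
Pendant G v = Σ _ λ u → Adj G v u × (∀ w → Adj G v w → w ≡ u)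

TwoLayered : ∀ {N} → Graph N → Fin N → Set
TwoLayered G v = ∀ u → Adj G v u → Σ _ λ p → Pendant G p × Adj G u p

_∖_ : ∀ {N} → SubG N → Subset N → SubG N
K ∖ Γ = record
  { V    = λ v → V K v × v ∉ Γ
  ; E    = λ u v → E K u v × u ∉ Γ × v ∉ Γ
  ; Esym = λ (e , nu , nv) → Esym K e , nv , nu
  ; Eend = λ (e , nu , nv) → (proj₁ (Eend K e) , nu) , (proj₂ (Eend K e) , nv)
  }
  where open import Data.Product using (_,_; proj₁; proj₂)

Nbhd : ∀ {N} → SubG N → Subset N → Fin N → Set
Nbhd K P v = Σ _ λ u → u ∈ P × E K v u

Stable : ∀ {N} → SubG N → Subset N → Set
Stable K S = (∀ v → v ∈ S → V K v) × (∀ u v → u ∈ S → v ∈ S → ¬ E K u v)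

MaxStable : ∀ {N} → SubG N → Subset N → Set
MaxStable K S = Stable K S × (∀ v → V K v → v ∉ S → ¬ Stable K (S ∪ ⁅ v ⁆))

-- S ∈ 𝓑_K(P, Q̄): maximal stable set of K containing P and avoiding Q
InB : ∀ {N} → SubG N → (Fin N → Set) → (Fin N → Set) → Subset N → Set
InB K P Q S = MaxStable K S × (∀ v → P v → v ∈ S) × (∀ v → Q v → v ∉ S)

{-# OPTIONS --safe #-}
module Submission where

open import Defs
open import Data.Nat using (ℕ; _≤_)
open import Data.Fin using (Fin)
open import Data.Fin.Subset using (Subset; _∈_; _∉_; _⊆_; _∪_; ⁅_⁆)
open import Data.Fin.Subset.Properties using (_∈?_; x∈p∪q⁻; x∈⁅y⁆⇒x≡y; ⊆-antisym)
open import Data.Bool using (Bool)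
open import Data.Product using (Σ; _×_; _,_; proj₁; proj₂)
open import Data.Sum using (_⊎_; inj₁; inj₂)
open import Relation.Nullary using (¬_)
open import Relation.Nullary.Decidable using (decidable-stable)
open import Relation.Binary.PropositionalEquality using (_≡_; _≢_; refl)

-- Suppose S lies in both families and v ∈ Γ₁ ∖ Γ₂. In C ∖ Γ₂ the vertex v is
-- still present, and all its C-neighbours lie in N_C(Γ₁), which S avoids; so
-- by maximality v ∈ S. But v ∈ [n] ∖ Θ is forbidden. Hence Γ₁ ⊆ Γ₂, and
-- symmetrically Γ₂ ⊆ Γ₁.

Loopless : ∀ {N} → SubG N → Set
Loopless K = ∀ {v} → ¬ E K v v

module _ {N : ℕ} (K : SubG N) where

  stable-∪-⁅⁆ : ∀ {S v} → Stable K S → V K v → Loopless K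
              → (∀ u → u ∈ S → ¬ E K v u) → Stable K (S ∪ ⁅ v ⁆)
  stable-∪-⁅⁆ {S} {v} (S⊆K , S-indep) v∈K loopless v-isolated =
    S∪v⊆K , S∪v-indep
    where
    split : ∀ {w} → w ∈ S ∪ ⁅ v ⁆ → w ∈ S ⊎ w ≡ v
    split w∈ with x∈p∪q⁻ S ⁅ v ⁆ w∈
    ... | inj₁ w∈S = inj₁ w∈S
    ... | inj₂ w∈v = inj₂ (x∈⁅y⁆⇒x≡y v w∈v)

    S∪v⊆K : ∀ w → w ∈ S ∪ ⁅ v ⁆ → V K w
    S∪v⊆K w w∈ with split w∈
    ... | inj₁ w∈S = S⊆K w w∈S
    ... | inj₂ refl = v∈K

    S∪v-indep : ∀ u w → u ∈ S ∪ ⁅ v ⁆ → w ∈ S ∪ ⁅ v ⁆ → ¬ E K u w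
    S∪v-indep u w u∈ w∈ e with split u∈ | split w∈
    ... | inj₁ u∈S  | inj₁ w∈S  = S-indep u w u∈S w∈S e
    ... | inj₂ refl | inj₁ w∈S  = v-isolated w w∈S e
    ... | inj₁ u∈S  | inj₂ refl = v-isolated u u∈S (Esym K e)
    ... | inj₂ refl | inj₂ refl = loopless e

  maxStable-dominating : ∀ {S v} → MaxStable K S → V K v → Loopless K → v ∉ S
                       → ¬ (∀ u → u ∈ S → ¬ E K v u)
  maxStable-dominating (stable , maximal) v∈K loopless v∉S v-isolated =
    maximal _ v∈K v∉S (stable-∪-⁅⁆ stable v∈K loopless v-isolated)

module _ {N : ℕ} (K : SubG N) where

  maxStable-∖-avoiding-Nbhd : ∀ {Γ Δ S v} → Loopless K
    → MaxStable (K ∖ Δ) S → (∀ u → Nbhd K Γ u → u ∉ S)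
    → v ∈ Γ → v ∉ Δ → V K v → v ∈ S
  maxStable-∖-avoiding-Nbhd {Δ = Δ} {S} {v} loopless maxStable avoid v∈Γ v∉Δ v∈K =
    decidable-stable (v ∈? S) λ v∉S →
      maxStable-dominating (K ∖ Δ) maxStable (v∈K , v∉Δ)
        (λ (e , _ , _) → loopless e) v∉S
        (λ u u∈S (e , _ , _) → avoid u (v , v∈Γ , Esym K e) u∈S)

  InB-∖-⊆ : ∀ {P R : Fin N → Set} {Γ₁ Γ₂ S} → Loopless K
    → (∀ v → v ∈ Γ₁ → V K v × R v)
    → InB (K ∖ Γ₁) P (λ v → R v ⊎ Nbhd K Γ₁ v) S → MaxStable (K ∖ Γ₂) S
    → Γ₁ ⊆ Γ₂
  InB-∖-⊆ {Γ₂ = Γ₂} loopless Γ₁-forbidden (_ , _ , avoid) maxStable {v} v∈Γ₁ =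
    decidable-stable (v ∈? Γ₂) λ v∉Γ₂ →
      avoid v (inj₁ (proj₂ (Γ₁-forbidden v v∈Γ₁)))
        (maxStable-∖-avoiding-Nbhd loopless maxStable (λ u u∈N → avoid u (inj₂ u∈N))
          v∈Γ₁ v∉Γ₂ (proj₁ (Γ₁-forbidden v v∈Γ₁)))

  InB-∖-disjoint : ∀ {P R : Fin N → Set} {Γ₁ Γ₂} → Loopless K
    → (∀ v → v ∈ Γ₁ → V K v × R v) → (∀ v → v ∈ Γ₂ → V K v × R v) → Γ₁ ≢ Γ₂
    → ¬ (Σ (Subset N) λ S → InB (K ∖ Γ₁) P (λ v → R v ⊎ Nbhd K Γ₁ v) S
                          × InB (K ∖ Γ₂) P (λ v → R v ⊎ Nbhd K Γ₂ v) S)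
  InB-∖-disjoint loopless Γ₁-forbidden Γ₂-forbidden Γ₁≢Γ₂ (S , S∈B₁ , S∈B₂) =
    Γ₁≢Γ₂ (⊆-antisym (InB-∖-⊆ loopless Γ₁-forbidden S∈B₁ (proj₁ S∈B₂))
                     (InB-∖-⊆ loopless Γ₂-forbidden S∈B₂ (proj₁ S∈B₁)))

lemma3p4 : (N n : ℕ) → n ≤ N → (G : Graph N) → (C H : SubG N)
    → Decomposition G C H
    → (Σ (Fin N → Bool) λ c → ProperColouring G c
         × (∀ i j → InN n i → InN n j → c i ≡ c j))
    → (∀ v → ((V C v × V H v) → InN n v) × (InN n v → (V C v × V H v)))
    → (∀ i → InN n i → TwoLayered G i)
    → (∀ i → InN n i → (Σ (Fin N) λ u → E C i u) × (Σ (Fin N) λ u → E H i u))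
    → (Θ Γ₁ Γ₂ : Subset N)
    → (∀ v → v ∈ Θ → InN n v)
    → (∀ v → v ∈ Γ₁ → InN n v × v ∉ Θ)
    → (∀ v → v ∈ Γ₂ → InN n v × v ∉ Θ)
    → Γ₁ ≢ Γ₂
    → (b : Fin N) → V C b
    → (¬ (Σ (Subset N) λ S →
            InB (C ∖ Γ₁) (λ v → v ∈ Θ) (λ v → (InN n v × v ∉ Θ) ⊎ Nbhd C Γ₁ v) S
          × InB (C ∖ Γ₂) (λ v → v ∈ Θ) (λ v → (InN n v × v ∉ Θ) ⊎ Nbhd C Γ₂ v) S))
      × (¬ (Σ (Subset N) λ S →
            InB (C ∖ Γ₁) (λ v → v ≡ b ⊎ v ∈ Θ) (λ v → (InN n v × v ∉ Θ) ⊎ Nbhd C Γ₁ v) S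
          × InB (C ∖ Γ₂) (λ v → v ≡ b ⊎ v ∈ Θ) (λ v → (InN n v × v ∉ Θ) ⊎ Nbhd C Γ₂ v) S))
lemma3p4 N n _ G C H dec _ shared _ _ Θ Γ₁ Γ₂ _ Γ₁⊆[n]∖Θ Γ₂⊆[n]∖Θ Γ₁≢Γ₂ _ _ =
  disjoint , disjoint
  where
  C-loopless : Loopless C
  C-loopless e = irrefl G (Decomposition.C-sub dec e)

  forbidden : ∀ {Γ} → (∀ v → v ∈ Γ → InN n v × v ∉ Θ)
            → ∀ v → v ∈ Γ → V C v × (InN n v × v ∉ Θ)
  forbidden Γ⊆ v v∈Γ = proj₁ (proj₂ (shared v) (proj₁ (Γ⊆ v v∈Γ))) , Γ⊆ v v∈Γ

  disjoint : ∀ {P} → ¬ (Σ (Subset N) λ S →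
      InB (C ∖ Γ₁) P (λ v → (InN n v × v ∉ Θ) ⊎ Nbhd C Γ₁ v) S
    × InB (C ∖ Γ₂) P (λ v → (InN n v × v ∉ Θ) ⊎ Nbhd C Γ₂ v) S)
  disjoint = InB-∖-disjoint C C-loopless (forbidden Γ₁⊆[n]∖Θ) (forbidden Γ₂⊆[n]∖Θ) Γ₁≢Γ₂
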